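{- Let $G=(V,E)$ be a finite simple graph that is $U$-threshold for some $U\subseteq V$, and let $U^c=V\setminus U$. Then: (a) $U^c$ is an independent set in $G$; (b) the neighborhoods of the vertices in $U^c$ are nested, i.e., for all $v,w\in U^c$, $N(v)\subseteq N(w)$ or $N(w)\subseteq N(v)$; (c) for all $v,w\in U$, $N_{U^c}(v)\subseteq N_{U^c}(w)$ or $N_{U^c}(w)\subseteq N_{U^c}(v)$; (d) $N_{U^c}(v)\supseteq N_{U^c}(w)$ for every $v,w\in U$ such that $v\prec w$ in $G[U]$.
   Context: Graphs are finite, without loops or parallel edges. $N(v)$ is the set of neighbors of $v$, and $N_W(v)=N(v)\cap W$ for $W\subseteq V$; $G[W]$ is the induced subgraph on $W$. For $U\subseteq V$, $G$ is $U$-threshold if for every nonempty $W\subseteq V$ the induced subgraph $G[W]$ contains a vertex $v$ with $N_W(v)=\emptyset$ or $N_W(v)=(W\setminus\{v\})\cap U$. In this case $G[U]$ is a threshold graph (every induced subgraph has an isolated or a dominating vertex), and it admits a construction order: an ordering $u_1,\dots,u_k$ of $U$ such that for each $i$, the set of neighbors of $u_i$ among $u_1,\dots,u_{i-1}$ is either empty or all of $\{u_1,\dots,u_{i-1}\}$. For $v,w\in U$, write $v\prec w$ in $G[U]$ if $v$ and $w$ have different degrees in $G[U]$ and $v$ precedes $w$ in every construction order of $G[U]$ (construction orders of a threshold graph are unique up to permuting vertices of equal degree). -}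

module Defs where

open import Data.Nat using (ℕ; _<_)
open import Data.Bool using (Bool; true; false)
open import Data.Fin using (Fin; _<_)
open import Data.Fin.Subset using (Subset; _∈_; _∉_; _∩_; ∣_∣)
open import Data.Vec using (tabulate)
open import Data.Product using (Σ; ∃; _×_; _,_)
open import Data.Sum using (_⊎_)
open import Function using (Injective)
open import Relation.Binary.PropositionalEquality using (_≡_; _≢_)
open import Relation.Nullary using (¬_)

record Graph (n : ℕ) : Set where
  field
    adj    : Fin n → Fin n → Bool
    sym    : ∀ u v → adj u v ≡ adj v u
    irrefl : ∀ v → adj v v ≡ false

module _ {n : ℕ} (G : Graph n) where
  open Graph G

  Adj : Fin n → Fin n → Set
  Adj u v = adj u v ≡ true

  N : Fin n → Subset n
  N v = tabulate (adj v)

  NoNbrIn : Subset n → Fin n → Set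
  NoNbrIn W v = ∀ u → u ∈ W → ¬ Adj v u

  NbrsAre : Subset n → Subset n → Fin n → Set
  NbrsAre U W v = ∀ u → u ∈ W → u ≢ v → (Adj v u → u ∈ U) × (u ∈ U → Adj v u)

  IsThreshold : Subset n → Set
  IsThreshold U = ∀ (W : Subset n) → (∃ λ w → w ∈ W) →
    ∃ λ v → v ∈ W × (NoNbrIn W v ⊎ NbrsAre U W v)

  degIn : Subset n → Fin n → ℕ
  degIn U v = ∣ U ∩ N v ∣

  IsConstructionOrder : Subset n → (k : ℕ) → (Fin k → Fin n) → Set
  IsConstructionOrder U k σ =
    Injective _≡_ _≡_ σ ×
    (∀ x → (x ∈ U → ∃ λ i → σ i ≡ x) × (∀ i → σ i ≡ x → x ∈ U)) ×
    (∀ i → (∀ j → j Data.Fin.< i → ¬ Adj (σ i) (σ j))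
         ⊎ (∀ j → j Data.Fin.< i → Adj (σ i) (σ j)))

  Prec : Subset n → Fin n → Fin n → Set
  Prec U v w = degIn U v ≢ degIn U w ×
    (∀ k (σ : Fin k → Fin n) → IsConstructionOrder U k σ →
       ∀ i j → σ i ≡ v → σ j ≡ w → i Data.Fin.< j)

{-# OPTIONS --safe #-}
-- A threshold vertex z of W has either no neighbour in W or exactly the vertices of U ∖ {z}
-- in W as neighbours, so z cannot be a misfit: a vertex with some neighbour in W and some
-- other vertex of W on which adjacency to z disagrees with membership in U. Two adjacent
-- vertices outside U, or v, w ∈ U and x, y ∉ U with v ∼ x, w ∼ y, v ≁ y, w ≁ x, form sets
-- consisting of misfits only; this gives (a), and, applied to a crossing of two
-- neighbourhoods, (b) and (c).
-- For (d), suppose w ∼ x ∉ U but v ≁ x. Peel U by repeatedly deleting a vertex that is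
-- isolated or dominating in what is left, never deleting w while v is still present:
-- while both remain in R, a threshold vertex of R ∪ {x} is neither x nor w. Read
-- backwards, the deletions form a construction order of G[U] listing w before v,
-- contradicting v ≺ w.
module Submission where

open import Defs
open import Data.Nat using (ℕ)
open import Data.Fin using (Fin)
open import Data.Fin.Subset using (Subset; _∈_; _∉_)
open import Data.Product using (_×_)
open import Data.Sum using (_⊎_)
open import Relation.Nullary using (¬_)

import Data.Nat as ℕ
open import Data.Nat.Properties using (∸-monoʳ-<)
open import Data.Bool using (true)
import Data.Bool as Bool
open import Data.Fin using (zero; suc; opposite; _<_)
open import Data.Fin.Properties
  using (_≟_; toℕ<n; opposite-prop; opposite-involutive; <-asym; any?)
open import Data.Fin.Subset using (_⊆_; _⊂_; _∪_; _─_; _-_; ⁅_⁆; ⋃; Nonempty; inside; outside)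
open import Data.Fin.Subset.Induction using (⊂-wellFounded)
open import Data.Fin.Subset.Properties
  using (_∈?_; nonempty?; x∈⁅x⁆; x∈⁅y⁆⇒x≡y; x∈p∪q⁻; p⊆p∪q; q⊆p∪q;
         p─q⊆p; x∈p∧x≢y⇒x∈p-y; x∈p⇒p-x⊂p; ∉⊥)
open import Data.List using (List; []; _∷_; map)
open import Data.List.Membership.Propositional using () renaming (_∈_ to _∈ₗ_)
open import Data.List.Relation.Unary.Any using (here; there)
open import Data.List.Relation.Unary.All as All using (All; []; _∷_)
open import Data.Vec using (_∷_; here; there)
import Data.Vec.Functional as Vector
open import Data.Product using (∃; ∃₂; _,_)
import Data.Product as Product
open import Data.Sum using (inj₁; inj₂)
import Data.Sum as Sum
open import Data.Empty using (⊥; ⊥-elim)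
open import Function using (_∘_; id; Injective)
open import Induction.WellFounded using (Acc; acc)
open import Relation.Nullary using (Dec; yes; no)
open import Relation.Nullary.Decidable using (_×-dec_; ¬?; decidable-stable)
open import Relation.Unary using (Pred; Decidable)
open import Relation.Binary.PropositionalEquality
  using (_≡_; _≢_; refl; sym; trans; cong; subst; subst₂)

opposite-< : ∀ {k} {i j : Fin k} → i < j → opposite j < opposite i
opposite-< {i = i} {j} i<j =
  subst₂ ℕ._<_ (sym (opposite-prop j)) (sym (opposite-prop i)) (∸-monoʳ-< (ℕ.s<s i<j) (toℕ<n j))

x∈p─q⇒x∉q : ∀ {n} (p q : Subset n) {x} → x ∈ p ─ q → x ∉ q
x∈p─q⇒x∉q (inside ∷ p) (outside ∷ q) here = λ ()
x∈p─q⇒x∉q (_ ∷ p) (_ ∷ q) (there x∈p─q) (there x∈q) = x∈p─q⇒x∉q p q x∈p─q x∈q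

fromList : ∀ {n} → List (Fin n) → Subset n
fromList = ⋃ ∘ map ⁅_⁆

∈-fromList⁺ : ∀ {n} {x : Fin n} xs → x ∈ₗ xs → x ∈ fromList xs
∈-fromList⁺ {x = x} (_ ∷ ys) (here refl) = p⊆p∪q (fromList ys) (x∈⁅x⁆ x)
∈-fromList⁺ (y ∷ ys) (there x∈ys) = q⊆p∪q ⁅ y ⁆ (fromList ys) (∈-fromList⁺ ys x∈ys)

∈-fromList⁻ : ∀ {n} {x : Fin n} xs → x ∈ fromList xs → x ∈ₗ xs
∈-fromList⁻ [] x∈⊥ = ⊥-elim (∉⊥ x∈⊥)
∈-fromList⁻ (y ∷ ys) x∈ with x∈p∪q⁻ ⁅ y ⁆ (fromList ys) x∈
... | inj₁ x∈⁅y⁆ = here (x∈⁅y⁆⇒x≡y y x∈⁅y⁆)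
... | inj₂ x∈ys = there (∈-fromList⁻ ys x∈ys)

nested-or-crossing : ∀ {n ℓ} {P Q : Pred (Fin n) ℓ} → Decidable P → Decidable Q →
  (∀ {x y} → P x → ¬ Q x → Q y → ¬ P y → ⊥) →
  (∀ x → P x → Q x) ⊎ (∀ x → Q x → P x)
nested-or-crossing P? Q? uncrossed with any? (λ x → P? x ×-dec ¬? (Q? x))
... | yes (x , Px , ¬Qx) = inj₂ λ y Qy → decidable-stable (P? y) (uncrossed Px ¬Qx Qy)
... | no ∄ = inj₁ λ x Px → decidable-stable (Q? x) λ ¬Qx → ∄ (x , Px , ¬Qx)

module _ {n} (G : Graph n) where

  Adj-sym : ∀ {a b} → Adj G a b → Adj G b a
  Adj-sym {a} {b} ab = trans (Graph.sym G b a) ab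

  Adj⇒≢ : ∀ {a b} → Adj G a b → a ≢ b
  Adj⇒≢ {a} aa refl with trans (sym aa) (Graph.irrefl G a)
  ... | ()

  Adj? : ∀ a b → Dec (Adj G a b)
  Adj? a b = Graph.adj G a b Bool.≟ true

  Dominates : Subset n → Fin n → Set
  Dominates R z = ∀ y → y ∈ R → y ≢ z → Adj G z y

  w-before-v⇒¬Prec : ∀ {U k σ v w} → IsConstructionOrder G U k σ → v ∈ U → w ∈ U →
    (∀ i j → σ i ≡ v → σ j ≡ w → j < i) → ¬ Prec G U v w
  w-before-v⇒¬Prec {k = k} {σ} co@(_ , covers , _) v∈U w∈U w-before-v (_ , v-before-w)
    with Product.proj₁ (covers _) v∈U | Product.proj₁ (covers _) w∈U
  ... | i , σi≡v | j , σj≡w =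
    <-asym (v-before-w k σ co i j σi≡v σj≡w) (w-before-v i j σi≡v σj≡w)

  module _ (v w : Fin n) where

    record EliminationOrder (R : Subset n) : Set where
      field
        size                   : ℕ
        τ                      : Fin size → Fin n
        injective              : Injective _≡_ _≡_ τ
        onto                   : ∀ y → y ∈ R → ∃ λ i → τ i ≡ y
        into                   : ∀ i → τ i ∈ R
        isolated-or-dominating : ∀ i → (∀ j → i < j → ¬ Adj G (τ i) (τ j))
                                     ⊎ (∀ j → i < j → Adj G (τ i) (τ j))
        v-before-w             : ∀ i j → τ i ≡ v → τ j ≡ w → i < j

    Eliminable : Subset n → Fin n → Set
    Eliminable R z = z ∈ R × (NoNbrIn G R z ⊎ Dominates R z) × (v ∈ R → w ∈ R → z ≢ w)

    []ᴱ : ∀ {R} → ¬ Nonempty R → EliminationOrder R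
    []ᴱ R≡∅ = record
      { size = 0 ; τ = λ () ; injective = λ { {()} } ; onto = λ y y∈R → ⊥-elim (R≡∅ (y , y∈R))
      ; into = λ () ; isolated-or-dominating = λ () ; v-before-w = λ () }

    _∷ᴱ_ : ∀ {R z} → Eliminable R z → EliminationOrder (R - z) → EliminationOrder R
    _∷ᴱ_ {R} {z} (z∈R , z-isolated-or-dominating , z≢w) E = record
      { size = ℕ.suc size ; τ = z∷τ ; injective = injective′ ; onto = onto′ ; into = into′
      ; isolated-or-dominating = isolated-or-dominating′ ; v-before-w = v-before-w′ }
      where
      open EliminationOrder E
      z∷τ : Fin (ℕ.suc size) → Fin n
      z∷τ = z Vector.∷ τ

      τ∈R : ∀ i → τ i ∈ R
      τ∈R i = p─q⊆p R ⁅ z ⁆ (into i)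

      τ≢z : ∀ i → τ i ≢ z
      τ≢z i τi≡z = x∈p─q⇒x∉q R ⁅ z ⁆ (into i) (subst (_∈ ⁅ z ⁆) (sym τi≡z) (x∈⁅x⁆ z))

      injective′ : Injective _≡_ _≡_ z∷τ
      injective′ {zero}  {zero}  _     = refl
      injective′ {zero}  {suc j} z≡τj  = ⊥-elim (τ≢z j (sym z≡τj))
      injective′ {suc i} {zero}  τi≡z  = ⊥-elim (τ≢z i τi≡z)
      injective′ {suc i} {suc j} τi≡τj = cong suc (injective τi≡τj)

      onto′ : ∀ y → y ∈ R → ∃ λ i → z∷τ i ≡ y
      onto′ y y∈R with y ≟ z
      ... | yes refl = zero , refl
      ... | no y≢z   = let (i , τi≡y) = onto y (x∈p∧x≢y⇒x∈p-y y∈R y≢z) in suc i , τi≡y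

      into′ : ∀ i → z∷τ i ∈ R
      into′ zero    = z∈R
      into′ (suc i) = τ∈R i

      isolated-or-dominating′ : ∀ i → (∀ j → i < j → ¬ Adj G (z∷τ i) (z∷τ j))
                                    ⊎ (∀ j → i < j → Adj G (z∷τ i) (z∷τ j))
      isolated-or-dominating′ zero = Sum.map
        (λ isolated → λ { (suc j) _ → isolated (τ j) (τ∈R j) })
        (λ dominates → λ { (suc j) _ → dominates (τ j) (τ∈R j) (τ≢z j) })
        z-isolated-or-dominating
      isolated-or-dominating′ (suc i) = Sum.map
        (λ isolated → λ { (suc j) i<j → isolated j (ℕ.s<s⁻¹ i<j) })
        (λ dominating → λ { (suc j) i<j → dominating j (ℕ.s<s⁻¹ i<j) })
        (isolated-or-dominating i)

      ¬[v∈R∧z≡w] : ∀ {y} → y ∈ R → y ≡ v → z ≡ w → ⊥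
      ¬[v∈R∧z≡w] y∈R y≡v z≡w = z≢w (subst (_∈ R) y≡v y∈R) (subst (_∈ R) z≡w z∈R) z≡w

      v-before-w′ : ∀ i j → z∷τ i ≡ v → z∷τ j ≡ w → i < j
      v-before-w′ zero    zero    z≡v  z≡w  = ⊥-elim (¬[v∈R∧z≡w] z∈R z≡v z≡w)
      v-before-w′ zero    (suc j) _    _    = ℕ.z<s
      v-before-w′ (suc i) zero    τi≡v z≡w  = ⊥-elim (¬[v∈R∧z≡w] (τ∈R i) τi≡v z≡w)
      v-before-w′ (suc i) (suc j) τi≡v τj≡w = ℕ.s<s (v-before-w i j τi≡v τj≡w)

    eliminationOrder : ∀ {S} → (∀ {R} → R ⊆ S → Nonempty R → ∃ (Eliminable R)) →
                       EliminationOrder S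
    eliminationOrder {S} eliminable = build S id (⊂-wellFounded S)
      where
      build : ∀ R → R ⊆ S → Acc _⊂_ R → EliminationOrder R
      build R R⊆S (acc smaller) with nonempty? R
      ... | no R≡∅ = []ᴱ R≡∅
      ... | yes R≢∅ with eliminable R⊆S R≢∅
      ... | z , z-eliminable@(z∈R , _) =
        z-eliminable ∷ᴱ build (R - z) (R⊆S ∘ p─q⊆p R ⁅ z ⁆) (smaller (x∈p⇒p-x⊂p z∈R))

    reverse : ∀ {R} → EliminationOrder R →
              ∃₂ λ k σ → IsConstructionOrder G R k σ × (∀ i j → σ i ≡ v → σ j ≡ w → j < i)
    reverse {R} E = size , σ , (σ-injective , σ-covers , σ-isolated-or-dominating) , w-before-v
      where
      open EliminationOrder E
      σ : Fin size → Fin n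
      σ = τ ∘ opposite

      σ-injective : Injective _≡_ _≡_ σ
      σ-injective {i} {j} σi≡σj =
        subst₂ _≡_ (opposite-involutive i) (opposite-involutive j) (cong opposite (injective σi≡σj))

      σ-covers : ∀ y → (y ∈ R → ∃ λ i → σ i ≡ y) × (∀ i → σ i ≡ y → y ∈ R)
      σ-covers y = (λ y∈R → let (i , τi≡y) = onto y y∈R in
                              opposite i , trans (cong τ (opposite-involutive i)) τi≡y)
                 , λ i σi≡y → subst (_∈ R) σi≡y (into (opposite i))

      σ-isolated-or-dominating : ∀ i → (∀ j → j < i → ¬ Adj G (σ i) (σ j))
                                     ⊎ (∀ j → j < i → Adj G (σ i) (σ j))
      σ-isolated-or-dominating i = Sum.map
        (λ isolated j j<i → isolated (opposite j) (opposite-< j<i))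
        (λ dominating j j<i → dominating (opposite j) (opposite-< j<i))
        (isolated-or-dominating (opposite i))

      w-before-v : ∀ i j → σ i ≡ v → σ j ≡ w → j < i
      w-before-v i j σi≡v σj≡w = subst₂ _<_ (opposite-involutive j) (opposite-involutive i)
        (opposite-< (v-before-w (opposite i) (opposite j) σi≡v σj≡w))

module _ {n} (G : Graph n) (U : Subset n) where

  ThresholdVertex : Subset n → Fin n → Set
  ThresholdVertex W z = NoNbrIn G W z ⊎ NbrsAre G U W z

  Misfit : Subset n → Fin n → Set
  Misfit W z = (∃ λ y → y ∈ W × Adj G z y)
             × (∃ λ y → y ∈ W × y ≢ z × ¬ ((Adj G z y → y ∈ U) × (y ∈ U → Adj G z y)))

  misfit⇒¬ThresholdVertex : ∀ {W z} → Misfit W z → ¬ ThresholdVertex W z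
  misfit⇒¬ThresholdVertex ((y , y∈W , zy) , _) (inj₁ isolated) = isolated y y∈W zy
  misfit⇒¬ThresholdVertex (_ , (y , y∈W , y≢z , mismatch)) (inj₂ nbrs) = mismatch (nbrs y y∈W y≢z)

  misfit-by-outside-nbr : ∀ {W y z} → y ∈ W → y ∉ U → Adj G z y → Misfit W z
  misfit-by-outside-nbr y∈W y∉U zy =
    (_ , y∈W , zy) , (_ , y∈W , Adj⇒≢ G (Adj-sym G zy) , λ (nbr⇒∈U , _) → y∉U (nbr⇒∈U zy))

  misfit-by-inside-non-nbr : ∀ {W y y′ z} → y ∈ W → Adj G z y →
    y′ ∈ W → y′ ∈ U → z ∉ U → ¬ Adj G z y′ → Misfit W z
  misfit-by-inside-non-nbr y∈W zy y′∈W y′∈U z∉U ¬zy′ =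
    (_ , y∈W , zy) ,
    (_ , y′∈W , (λ { refl → z∉U y′∈U }) , λ (_ , ∈U⇒nbr) → ¬zy′ (∈U⇒nbr y′∈U))

  ThresholdVertex-restrict : ∀ {R W z} → R ⊆ W → R ⊆ U →
    ThresholdVertex W z → NoNbrIn G R z ⊎ Dominates G R z
  ThresholdVertex-restrict R⊆W R⊆U = Sum.map
    (λ isolated y y∈R → isolated y (R⊆W y∈R))
    (λ nbrs y y∈R y≢z → Product.proj₂ (nbrs y (R⊆W y∈R) y≢z) (R⊆U y∈R))

  module _ (threshold : IsThreshold G U) where

    ¬all-misfits : ∀ x xs → ¬ All (Misfit (fromList (x ∷ xs))) (x ∷ xs)
    ¬all-misfits x xs misfits with threshold (fromList (x ∷ xs)) (x , ∈-fromList⁺ (x ∷ xs) (here refl))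
    ... | z , z∈W , z-threshold =
      misfit⇒¬ThresholdVertex (All.lookup misfits (∈-fromList⁻ (x ∷ xs) z∈W)) z-threshold

    Uᶜ-independent : ∀ v w → v ∉ U → w ∉ U → ¬ Adj G v w
    Uᶜ-independent v w v∉U w∉U vw = ¬all-misfits v (w ∷ [])
      ( misfit-by-outside-nbr (∈W (there (here refl))) w∉U vw
      ∷ misfit-by-outside-nbr (∈W (here refl)) v∉U (Adj-sym G vw)
      ∷ [])
      where
      ∈W : ∀ {z} → z ∈ₗ v ∷ w ∷ [] → z ∈ fromList (v ∷ w ∷ [])
      ∈W = ∈-fromList⁺ (v ∷ w ∷ [])

    no-crossing : ∀ {v w x y} → v ∈ U → w ∈ U → x ∉ U → y ∉ U →
      Adj G v x → Adj G w y → ¬ Adj G w x → ¬ Adj G v y → ⊥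
    no-crossing {v} {w} {x} {y} v∈U w∈U x∉U y∉U vx wy ¬wx ¬vy = ¬all-misfits v (w ∷ x ∷ y ∷ [])
      ( misfit-by-outside-nbr x∈W x∉U vx
      ∷ misfit-by-outside-nbr y∈W y∉U wy
      ∷ misfit-by-inside-non-nbr v∈W (Adj-sym G vx) w∈W w∈U x∉U (¬wx ∘ Adj-sym G)
      ∷ misfit-by-inside-non-nbr w∈W (Adj-sym G wy) v∈W v∈U y∉U (¬vy ∘ Adj-sym G)
      ∷ [])
      where
      W : Subset n
      W = fromList (v ∷ w ∷ x ∷ y ∷ [])
      ∈W : ∀ {z} → z ∈ₗ v ∷ w ∷ x ∷ y ∷ [] → z ∈ W
      ∈W = ∈-fromList⁺ (v ∷ w ∷ x ∷ y ∷ [])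
      v∈W : v ∈ W
      v∈W = ∈W (here refl)
      w∈W : w ∈ W
      w∈W = ∈W (there (here refl))
      x∈W : x ∈ W
      x∈W = ∈W (there (there (here refl)))
      y∈W : y ∈ W
      y∈W = ∈W (there (there (there (here refl))))

    Uᶜ-nested : ∀ v w → v ∉ U → w ∉ U →
      (∀ x → Adj G v x → Adj G w x) ⊎ (∀ x → Adj G w x → Adj G v x)
    Uᶜ-nested v w v∉U w∉U = nested-or-crossing (Adj? G v) (Adj? G w) crossing⇒⊥
      where
      crossing⇒⊥ : ∀ {x y} → Adj G v x → ¬ Adj G w x → Adj G w y → ¬ Adj G v y → ⊥
      crossing⇒⊥ {x} {y} vx ¬wx wy ¬vy with x ∈? U | y ∈? U
      ... | no x∉U  | _       = Uᶜ-independent v x v∉U x∉U vx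
      ... | yes _   | no y∉U  = Uᶜ-independent w y w∉U y∉U wy
      ... | yes x∈U | yes y∈U = no-crossing x∈U y∈U v∉U w∉U
        (Adj-sym G vx) (Adj-sym G wy) (¬vy ∘ Adj-sym G) (¬wx ∘ Adj-sym G)

    Uᶜ-nbrs-nested : ∀ v w → v ∈ U → w ∈ U →
      (∀ x → x ∉ U → Adj G v x → Adj G w x) ⊎ (∀ x → x ∉ U → Adj G w x → Adj G v x)
    Uᶜ-nbrs-nested v w v∈U w∈U =
      Sum.map curry-⊆ curry-⊆ (nested-or-crossing (Uᶜ-nbr? v) (Uᶜ-nbr? w) crossing⇒⊥)
      where
      Uᶜ-nbr? : ∀ a x → Dec (x ∉ U × Adj G a x)
      Uᶜ-nbr? a x = ¬? (x ∈? U) ×-dec Adj? G a x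

      curry-⊆ : ∀ {a b} → (∀ x → x ∉ U × Adj G a x → x ∉ U × Adj G b x) →
                ∀ x → x ∉ U → Adj G a x → Adj G b x
      curry-⊆ ⊆ x x∉U ax = Product.proj₂ (⊆ x (x∉U , ax))

      crossing⇒⊥ : ∀ {x y} → x ∉ U × Adj G v x → ¬ (x ∉ U × Adj G w x) →
                   y ∉ U × Adj G w y → ¬ (y ∉ U × Adj G v y) → ⊥
      crossing⇒⊥ (x∉U , vx) ¬wx (y∉U , wy) ¬vy =
        no-crossing v∈U w∈U x∉U y∉U vx wy (¬wx ∘ (x∉U ,_)) (¬vy ∘ (y∉U ,_))

    eliminable-without-v-or-w : ∀ {v w R} → R ⊆ U → Nonempty R → ¬ (v ∈ R × w ∈ R) →
      ∃ (Eliminable G v w R)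
    eliminable-without-v-or-w {R = R} R⊆U R≢∅ ¬[v,w∈R] =
      let (z , z∈R , z-threshold) = threshold R R≢∅ in
      z , z∈R , ThresholdVertex-restrict id R⊆U z-threshold , λ v∈R w∈R _ → ¬[v,w∈R] (v∈R , w∈R)

    eliminable-other-than-w : ∀ {v w x R} → R ⊆ U → v ∈ R → w ∈ R →
      v ∈ U → x ∉ U → Adj G w x → ¬ Adj G v x → ∃ (Eliminable G v w R)
    eliminable-other-than-w {v} {w} {x} {R} R⊆U v∈R w∈R v∈U x∉U wx ¬vx
      with threshold (R ∪ ⁅ x ⁆) (x , x∈W)
      where
      x∈W : x ∈ R ∪ ⁅ x ⁆
      x∈W = q⊆p∪q R ⁅ x ⁆ (x∈⁅x⁆ x)
    ... | z , z∈W , z-threshold with x∈p∪q⁻ R ⁅ x ⁆ z∈W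
    ... | inj₁ z∈R = z , z∈R , ThresholdVertex-restrict (p⊆p∪q ⁅ x ⁆) R⊆U z-threshold ,
      λ { _ _ refl → misfit⇒¬ThresholdVertex w-misfit z-threshold }
      where
      w-misfit : Misfit (R ∪ ⁅ x ⁆) w
      w-misfit = misfit-by-outside-nbr (q⊆p∪q R ⁅ x ⁆ (x∈⁅x⁆ x)) x∉U wx
    ... | inj₂ z∈⁅x⁆ with refl ← x∈⁅y⁆⇒x≡y x z∈⁅x⁆ =
      ⊥-elim (misfit⇒¬ThresholdVertex x-misfit z-threshold)
      where
      x-misfit : Misfit (R ∪ ⁅ x ⁆) x
      x-misfit = misfit-by-inside-non-nbr (p⊆p∪q ⁅ x ⁆ w∈R) (Adj-sym G wx)
                                          (p⊆p∪q ⁅ x ⁆ v∈R) v∈U x∉U (¬vx ∘ Adj-sym G)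

    eliminable : ∀ {v w x} → v ∈ U → x ∉ U → Adj G w x → ¬ Adj G v x →
                 ∀ {R} → R ⊆ U → Nonempty R → ∃ (Eliminable G v w R)
    eliminable {v} {w} v∈U x∉U wx ¬vx {R} R⊆U R≢∅ with v ∈? R ×-dec w ∈? R
    ... | no ¬[v,w∈R]     = eliminable-without-v-or-w R⊆U R≢∅ ¬[v,w∈R]
    ... | yes (v∈R , w∈R) = eliminable-other-than-w R⊆U v∈R w∈R v∈U x∉U wx ¬vx

    Prec⇒Uᶜ-nbrs-⊇ : ∀ v w → v ∈ U → w ∈ U → Prec G U v w →
      ∀ x → x ∉ U → Adj G w x → Adj G v x
    Prec⇒Uᶜ-nbrs-⊇ v w v∈U w∈U v≺w x x∉U wx = decidable-stable (Adj? G v x) λ ¬vx →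
      let (_ , _ , σ-construction , w-before-v) =
            reverse G v w (eliminationOrder G v w (eliminable v∈U x∉U wx ¬vx))
      in w-before-v⇒¬Prec G σ-construction v∈U w∈U w-before-v v≺w

lemma3p7 : ∀ {n : ℕ} (G : Graph n) (U : Subset n) → IsThreshold G U →
    (∀ v w → v ∉ U → w ∉ U → ¬ Adj G v w)
    × (∀ v w → v ∉ U → w ∉ U →
         (∀ x → Adj G v x → Adj G w x) ⊎ (∀ x → Adj G w x → Adj G v x))
    × (∀ v w → v ∈ U → w ∈ U →
         (∀ x → x ∉ U → Adj G v x → Adj G w x)
         ⊎ (∀ x → x ∉ U → Adj G w x → Adj G v x))
    × (∀ v w → v ∈ U → w ∈ U → Prec G U v w →
         (∀ x → x ∉ U → Adj G w x → Adj G v x))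
lemma3p7 G U threshold =
    Uᶜ-independent G U threshold
  , Uᶜ-nested G U threshold
  , Uᶜ-nbrs-nested G U threshold
  , Prec⇒Uᶜ-nbrs-⊇ G U threshold
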